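{- Let $f:\{0,1\}^n\to\{0,1\}$, let $s\ge1$ be an integer, $\varepsilon>0$, and let $h_1,\dots,h_{s'}:\{0,1\}^n\to\{0,1\}$ with $s'\le s$ be functions such that $h_i^{ -1}(1)\subseteq f^{ -1}(1)$ for each $i$ and $$\frac{|f^{ -1}(1)\setminus \bigcup_i h_i^{ -1}(1)|}{|f^{ -1}(1)|}\le\frac{\varepsilon}{2}.$$ If for each $i\in[s']$ there is a $t_i$-term DNF $h_i'$ with $\mathrm{reldist}(h_i,h_i')\le\varepsilon/(2s)$, and $\sum_i t_i\le s$, then there is an $s$-term DNF $g$ with $\mathrm{reldist}(f,g)\le\varepsilon$.
   Context: $\mathrm{reldist}(f,g)=|f^{ -1}(1)\triangle g^{ -1}(1)|/|f^{ -1}(1)|$. A $t$-term DNF is a disjunction of at most $t$ conjunctions of literals.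
   Formalization: The parameter ε ranges over the positive rationals. -}

module Defs where

open import Data.Bool using (Bool; true; false; _∧_; _xor_; not; if_then_else_)
open import Data.Nat using (ℕ; zero; suc; _+_)
open import Data.Integer using (+_)
open import Data.Fin using (Fin)
open import Data.Vec using (Vec; []; _∷_)
open import Data.List using (List; []; _∷_; map; _++_; allFin; length)
open import Data.Nat.ListAction using (sum)
open import Data.Bool.ListAction using (any)
open import Data.Product using (_×_; _,_)
open import Data.Rational using (ℚ; _/_; _*_; _≤_; 0ℚ)
import Data.Rational as ℚ

BoolFun : ℕ → Set
BoolFun n = Vec Bool n → Bool

allInputs : (n : ℕ) → List (Vec Bool n)
allInputs zero = [] ∷ []
allInputs (suc n) = map (true ∷_) (allInputs n) ++ map (false ∷_) (allInputs n)

count : {n : ℕ} → BoolFun n → ℕ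
count {n} p = sum (map (λ x → if p x then 1 else 0) (allInputs n))

toℚ : ℕ → ℚ
toℚ k = (+ k) / 1

-- reldist(f,g) ≤ δ, i.e. |f^{-1}(1) △ g^{-1}(1)| / |f^{-1}(1)| ≤ δ,
-- stated with the denominator multiplied out: |f⁻¹(1) △ g⁻¹(1)| ≤ δ · |f⁻¹(1)|.
RelDistLE : {n : ℕ} → BoolFun n → BoolFun n → ℚ → Set
RelDistLE f g δ = toℚ (count (λ x → f x xor g x)) ≤ δ * toℚ (count f)

-- q / k for a natural k (only used with k ≥ 1; value at k = 0 irrelevant)
divℕ : ℚ → ℕ → ℚ
divℕ q zero = 0ℚ
divℕ q (suc k) = q * ((+ 1) / suc k)

-- DNFs: a literal is (variable index, required value); a term is a conjunction
-- of literals; a DNF is a disjunction (list) of terms. A t-term DNF has length ≤ t.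
Literal : ℕ → Set
Literal n = Fin n × Bool

Term : ℕ → Set
Term n = List (Literal n)

DNF : ℕ → Set
DNF n = List (Term n)

evalLit : {n : ℕ} → Literal n → Vec Bool n → Bool
evalLit (i , true) x = Data.Vec.lookup x i
evalLit (i , false) x = not (Data.Vec.lookup x i)

evalTerm : {n : ℕ} → Term n → Vec Bool n → Bool
evalTerm [] x = true
evalTerm (l ∷ ls) x = evalLit l x ∧ evalTerm ls x

evalDNF : {n : ℕ} → DNF n → BoolFun n
evalDNF φ x = any (λ T → evalTerm T x) φ

bigOr : {n k : ℕ} → (Fin k → BoolFun n) → BoolFun n
bigOr {k = k} h x = any (λ i → h i x) (allFin k)

sumFin : {k : ℕ} → (Fin k → ℕ) → ℕ
sumFin {k} t = sum (map t (allFin k))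

{-# OPTIONS --safe #-}
-- Take g to be the concatenation of the approximating DNFs h′ᵢ; it has Σ tᵢ ≤ s terms.
-- Since every hᵢ⁻¹(1) lies inside f⁻¹(1), pointwise f △ g ⊆ (f ∖ ⋃ hᵢ) ∪ ⋃ (hᵢ △ h′ᵢ):
-- the first part has at most (ε/2)|f⁻¹(1)| points, and each of the s′ ≤ s others at most
-- (ε/2s)|hᵢ⁻¹(1)| ≤ (ε/2s)|f⁻¹(1)|, for a total of at most ε|f⁻¹(1)|.
module Submission where

open import Defs
open import Data.Bool using (Bool; true; false; _∧_; not)
open import Data.Nat using (ℕ; _≤_)
open import Data.Fin using (Fin)
open import Data.Vec using (Vec)
open import Data.List using (length)
open import Data.Product using (Σ; _×_)
open import Data.Rational using (ℚ; _<_; 0ℚ; ½; _*_)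
open import Relation.Binary.PropositionalEquality using (_≡_)

open import Data.Bool using (_∨_; _xor_; if_then_else_)
open import Data.Bool.ListAction using (any)
import Data.Bool.Properties as Bool
open import Data.Nat as ℕ using (zero; suc; z≤n; s≤s)
import Data.Nat.Properties as ℕ
open import Data.Nat.ListAction using (sum)
open import Data.Nat.Coprimality as Coprime using (1-coprimeTo)
open import Data.Integer.Solver using () renaming (module +-*-Solver to ℤSolver)
open import Data.Integer as ℤ using (+_)
import Data.Integer.Properties as ℤ
open import Data.List using (List; []; _∷_; map; _++_; concatMap; allFin)
import Data.List.Properties as List
open import Data.Product using (_,_; proj₁; proj₂)
open import Data.Rational as ℚ using (mkℚ; *≤*; _+_; NonNegative; toℚᵘ)
import Data.Rational.Properties as ℚ
open import Data.Rational.Solver using () renaming (module +-*-Solver to ℚSolver)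
import Data.Rational.Unnormalised as ℚᵘ
import Data.Rational.Unnormalised.Properties as ℚᵘ
open import Function using (_∘_)
open import Relation.Binary.PropositionalEquality using (refl; sym; trans; cong; subst; subst₂)

open import Algebra.Properties.CommutativeSemigroup ℕ.+-commutativeSemigroup using (interchange)

private
  variable
    n : ℕ
    I J : Set

indicator : Bool → ℕ
indicator b = if b then 1 else 0

indicator≤1 : ∀ b → indicator b ≤ 1
indicator≤1 true  = ℕ.≤-refl
indicator≤1 false = z≤n

indicator-mono : ∀ {a b} → (a ≡ true → b ≡ true) → indicator a ≤ indicator b
indicator-mono {false} _   = z≤n
indicator-mono {true}  a⇒b rewrite a⇒b refl = ℕ.≤-refl

xor-triangle : ∀ a b c → indicator (a xor c) ≤ indicator (a xor b) ℕ.+ indicator (b xor c)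
xor-triangle true  true  c = ℕ.≤-refl
xor-triangle true  false c = ℕ.≤-trans (indicator≤1 (not c)) (s≤s z≤n)
xor-triangle false true  c = ℕ.≤-trans (indicator≤1 c) (s≤s z≤n)
xor-triangle false false c = ℕ.≤-refl

∨-xor-≤ : ∀ a b c d → indicator ((a ∨ b) xor (c ∨ d)) ≤ indicator (a xor c) ℕ.+ indicator (b xor d)
∨-xor-≤ true  b true  d = z≤n
∨-xor-≤ true  b false d = ℕ.≤-trans (indicator≤1 (not d)) (s≤s z≤n)
∨-xor-≤ false b true  d = ℕ.≤-trans (indicator≤1 (b xor true)) (s≤s z≤n)
∨-xor-≤ false b false d = ℕ.≤-refl

xor≡∧-not : ∀ {a b} → (b ≡ true → a ≡ true) → a xor b ≡ a ∧ not b
xor≡∧-not {true}           _   = refl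
xor≡∧-not {false} {false}  _   = refl
xor≡∧-not {false} {true}   b⇒a with () ← b⇒a refl

any-++ : ∀ {A : Set} (p : A → Bool) xs ys → any p (xs ++ ys) ≡ any p xs ∨ any p ys
any-++ p []       ys = refl
any-++ p (x ∷ xs) ys = trans (cong (p x ∨_) (any-++ p xs ys)) (sym (Bool.∨-assoc (p x) _ _))

any-true⇒ : ∀ {p : I → Bool} {b} → (∀ i → p i ≡ true → b ≡ true) → ∀ is → any p is ≡ true → b ≡ true
any-true⇒ {p = p} p⇒b (i ∷ is) any≡true with p i in pi≡
... | true  = p⇒b i pi≡
... | false = any-true⇒ p⇒b is any≡true

any-xor-≤-sum : ∀ (p q : I → Bool) is →
  indicator (any p is xor any q is) ≤ sum (map (λ i → indicator (p i xor q i)) is)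
any-xor-≤-sum p q []       = z≤n
any-xor-≤-sum p q (i ∷ is) =
  ℕ.≤-trans (∨-xor-≤ (p i) _ (q i) _) (ℕ.+-monoʳ-≤ _ (any-xor-≤-sum p q is))

xor-any-≤ : ∀ a (p q : I → Bool) is → (∀ i → p i ≡ true → a ≡ true) →
  indicator (a xor any q is) ≤ indicator (a ∧ not (any p is)) ℕ.+ sum (map (λ i → indicator (p i xor q i)) is)
xor-any-≤ a p q is p⇒a = begin
  indicator (a xor any q is)                                         ≤⟨ xor-triangle a (any p is) (any q is) ⟩
  indicator (a xor any p is) ℕ.+ indicator (any p is xor any q is)   ≡⟨ cong (λ b → indicator b ℕ.+ _) (xor≡∧-not (any-true⇒ p⇒a is)) ⟩
  indicator (a ∧ not (any p is)) ℕ.+ indicator (any p is xor any q is) ≤⟨ ℕ.+-monoʳ-≤ _ (any-xor-≤-sum p q is) ⟩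
  indicator (a ∧ not (any p is)) ℕ.+ sum (map (λ i → indicator (p i xor q i)) is) ∎
  where open ℕ.≤-Reasoning

sum-map-mono : ∀ {f g : I → ℕ} → (∀ i → f i ≤ g i) → ∀ is → sum (map f is) ≤ sum (map g is)
sum-map-mono f≤g []       = z≤n
sum-map-mono f≤g (i ∷ is) = ℕ.+-mono-≤ (f≤g i) (sum-map-mono f≤g is)

sum-map-+ : ∀ (f g : I → ℕ) is → sum (map (λ i → f i ℕ.+ g i) is) ≡ sum (map f is) ℕ.+ sum (map g is)
sum-map-+ f g []       = refl
sum-map-+ f g (i ∷ is) = trans (cong (f i ℕ.+ g i ℕ.+_) (sum-map-+ f g is)) (interchange (f i) (g i) _ _)

sum-map-zero : ∀ (is : List I) → sum (map (λ _ → 0) is) ≡ 0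
sum-map-zero []       = refl
sum-map-zero (i ∷ is) = sum-map-zero is

sum-map-comm : ∀ (d : I → J → ℕ) is js →
  sum (map (λ j → sum (map (λ i → d i j) is)) js) ≡ sum (map (λ i → sum (map (d i) js)) is)
sum-map-comm d is []       = sym (sum-map-zero is)
sum-map-comm d is (j ∷ js) = trans
  (cong (sum (map (λ i → d i j) is) ℕ.+_) (sum-map-comm d is js))
  (sym (sum-map-+ (λ i → d i j) (λ i → sum (map (d i) js)) is))

_⊆_ : BoolFun n → BoolFun n → Set
p ⊆ q = ∀ x → p x ≡ true → q x ≡ true

_△_ : BoolFun n → BoolFun n → BoolFun n
(p △ q) x = p x xor q x

_∖_ : BoolFun n → BoolFun n → BoolFun n
(p ∖ q) x = p x ∧ not (q x)

count-cong : ∀ {p q : BoolFun n} → (∀ x → p x ≡ q x) → count p ≡ count q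
count-cong {n} p≗q = cong sum (List.map-cong (λ x → cong indicator (p≗q x)) (allInputs n))

count-mono : ∀ {p q : BoolFun n} → p ⊆ q → count p ≤ count q
count-mono {n} p⊆q = sum-map-mono (λ x → indicator-mono (p⊆q x)) (allInputs n)

count-△-bigOr-≤ : ∀ {k} (f : BoolFun n) (h ψ : Fin k → BoolFun n) → (∀ i → h i ⊆ f) →
  count (f △ bigOr ψ) ≤ count (f ∖ bigOr h) ℕ.+ sumFin (λ i → count (h i △ ψ i))
count-△-bigOr-≤ {n} {k} f h ψ h⊆f = begin
  count (f △ bigOr ψ)
    ≤⟨ sum-map-mono (λ x → xor-any-≤ (f x) (λ i → h i x) (λ i → ψ i x) (allFin k) (λ i → h⊆f i x)) (allInputs n) ⟩
  sum (map (λ x → indicator ((f ∖ bigOr h) x) ℕ.+ sum (map (λ i → err i x) (allFin k))) (allInputs n))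
    ≡⟨ sum-map-+ _ _ (allInputs n) ⟩
  count (f ∖ bigOr h) ℕ.+ sum (map (λ x → sum (map (λ i → err i x) (allFin k))) (allInputs n))
    ≡⟨ cong (count (f ∖ bigOr h) ℕ.+_) (sum-map-comm err (allFin k) (allInputs n)) ⟩
  count (f ∖ bigOr h) ℕ.+ sumFin (λ i → count (h i △ ψ i)) ∎
  where
  open ℕ.≤-Reasoning
  err : Fin k → Vec Bool n → ℕ
  err i x = indicator ((h i △ ψ i) x)

evalDNF-concatMap : ∀ (φ : I → DNF n) is x → evalDNF (concatMap φ is) x ≡ any (λ i → evalDNF (φ i) x) is
evalDNF-concatMap φ []       x = refl
evalDNF-concatMap φ (i ∷ is) x = trans
  (any-++ (λ T → evalTerm T x) (φ i) (concatMap φ is))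
  (cong (evalDNF (φ i) x ∨_) (evalDNF-concatMap φ is x))

length-concatMap : ∀ {A : Set} (φ : I → List A) is → length (concatMap φ is) ≡ sum (map (length ∘ φ) is)
length-concatMap φ []       = refl
length-concatMap φ (i ∷ is) = trans (List.length-++ (φ i)) (cong (length (φ i) ℕ.+_) (length-concatMap φ is))

toℚ-nonNeg : ∀ k → NonNegative (toℚ k)
toℚ-nonNeg k = ℚ.normalize-nonNeg k 1

toℚ≡mkℚ : ∀ k → toℚ k ≡ mkℚ (+ k) 0 (Coprime.sym (1-coprimeTo k))
toℚ≡mkℚ k = ℚ.normalize-coprime (Coprime.sym (1-coprimeTo k))

toℚ-mono-≤ : ∀ {a b} → a ≤ b → toℚ a ℚ.≤ toℚ b
toℚ-mono-≤ {a} {b} a≤b rewrite toℚ≡mkℚ a | toℚ≡mkℚ b =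
  *≤* (subst₂ ℤ._≤_ (sym (ℤ.*-identityʳ (+ a))) (sym (ℤ.*-identityʳ (+ b))) (ℤ.+≤+ a≤b))

toℚᵘ-toℚ : ∀ k → toℚᵘ (toℚ k) ℚᵘ.≃ ℚᵘ.mkℚᵘ (+ k) 0
toℚᵘ-toℚ k = ℚ.toℚᵘ-fromℚᵘ (ℚᵘ.mkℚᵘ (+ k) 0)

toℚ-homo-+ : ∀ a b → toℚ (a ℕ.+ b) ≡ toℚ a + toℚ b
toℚ-homo-+ a b = ℚ.toℚᵘ-injective (begin
  toℚᵘ (toℚ (a ℕ.+ b))                 ≈⟨ toℚᵘ-toℚ (a ℕ.+ b) ⟩
  ℚᵘ.mkℚᵘ (+ (a ℕ.+ b)) 0              ≈⟨ ℚᵘ.*≡* ℤ-identity ⟩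
  ℚᵘ.mkℚᵘ (+ a) 0 ℚᵘ.+ ℚᵘ.mkℚᵘ (+ b) 0 ≈⟨ ℚᵘ.+-cong (toℚᵘ-toℚ a) (toℚᵘ-toℚ b) ⟨
  toℚᵘ (toℚ a) ℚᵘ.+ toℚᵘ (toℚ b)       ≈⟨ ℚ.toℚᵘ-homo-+ (toℚ a) (toℚ b) ⟨
  toℚᵘ (toℚ a + toℚ b)                 ∎)
  where
  open ℚᵘ.≃-Reasoning
  ℤ-identity : + (a ℕ.+ b) ℤ.* (+ 1 ℤ.* + 1) ≡ (+ a ℤ.* + 1 ℤ.+ + b ℤ.* + 1) ℤ.* + 1
  ℤ-identity = trans
    (cong (ℤ._* (+ 1 ℤ.* + 1)) (ℤ.pos-+ a b))
    (solve 2 (λ x y → (x :+ y) :* (con (+ 1) :* con (+ 1)) := (x :* con (+ 1) :+ y :* con (+ 1)) :* con (+ 1)) refl (+ a) (+ b))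
    where open ℤSolver

toℚ-*-1/double≡½ : ∀ m → toℚ (suc m) * (+ 1 ℚ./ (2 ℕ.* suc m)) ≡ ½
toℚ-*-1/double≡½ m = ℚ.toℚᵘ-injective (begin
  toℚᵘ (toℚ (suc m) * r)                            ≈⟨ ℚ.toℚᵘ-homo-* (toℚ (suc m)) r ⟩
  toℚᵘ (toℚ (suc m)) ℚᵘ.* toℚᵘ r                    ≈⟨ ℚᵘ.*-cong (toℚᵘ-toℚ (suc m)) (ℚ.toℚᵘ-fromℚᵘ rᵘ) ⟩
  ℚᵘ.mkℚᵘ (+ suc m) 0 ℚᵘ.* rᵘ                       ≈⟨ ℚᵘ.*≡* ℤ-identity ⟩
  ℚᵘ.½                                              ∎)
  where
  open ℚᵘ.≃-Reasoning
  rᵘ : ℚᵘ.ℚᵘ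
  rᵘ = ℚᵘ.mkℚᵘ (+ 1) (ℕ.pred (2 ℕ.* suc m))
  r : ℚ
  r = ℚ.fromℚᵘ rᵘ
  ℤ-identity : (+ suc m ℤ.* + 1) ℤ.* + 2 ≡ + 1 ℤ.* (+ 1 ℤ.* + (2 ℕ.* suc m))
  ℤ-identity = trans
    (solve 1 (λ s → (s :* con (+ 1)) :* con (+ 2) := con (+ 1) :* (con (+ 1) :* (con (+ 2) :* s))) refl (+ suc m))
    (cong (λ z → + 1 ℤ.* (+ 1 ℤ.* z)) (sym (ℤ.pos-* 2 (suc m))))
    where open ℤSolver

toℚ-*-divℕ-double : ∀ m q → toℚ (suc m) * divℕ q (2 ℕ.* suc m) ≡ q * ½
toℚ-*-divℕ-double m q = trans
  (solve 3 (λ s q r → s :* (q :* r) := q :* (s :* r)) refl (toℚ (suc m)) q (+ 1 ℚ./ (2 ℕ.* suc m)))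
  (cong (q *_) (toℚ-*-1/double≡½ m))
  where open ℚSolver

divℕ-nonNeg : ∀ q k → .{{NonNegative q}} → NonNegative (divℕ q k)
divℕ-nonNeg q zero = _
divℕ-nonNeg q (suc k) = ℚ.nonNeg*nonNeg⇒nonNeg q (+ 1 ℚ./ suc k) {{ℚ.normalize-nonNeg 1 (suc k)}}

toℚ-sum-≤ : ∀ (d : I → ℕ) {c} → (∀ i → toℚ (d i) ℚ.≤ c) → ∀ is → toℚ (sum (map d is)) ℚ.≤ toℚ (length is) * c
toℚ-sum-≤ d {c} d≤c []       = ℚ.≤-reflexive (sym (ℚ.*-zeroˡ c))
toℚ-sum-≤ d {c} d≤c (i ∷ is) = begin
  toℚ (d i ℕ.+ sum (map d is))         ≡⟨ toℚ-homo-+ (d i) _ ⟩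
  toℚ (d i) + toℚ (sum (map d is))     ≤⟨ ℚ.+-mono-≤ (d≤c i) (toℚ-sum-≤ d d≤c is) ⟩
  c + toℚ (length is) * c              ≡⟨ solve 2 (λ c l → c :+ l :* c := (con ℚ.1ℚ :+ l) :* c) refl c (toℚ (length is)) ⟩
  (ℚ.1ℚ + toℚ (length is)) * c         ≡⟨ cong (_* c) (toℚ-homo-+ 1 (length is)) ⟨
  toℚ (suc (length is)) * c            ∎
  where
  open ℚ.≤-Reasoning
  open ℚSolver

toℚ-sumFin-≤ : ∀ {k} (d : Fin k → ℕ) {c} → (∀ i → toℚ (d i) ℚ.≤ c) → toℚ (sumFin d) ℚ.≤ toℚ k * c
toℚ-sumFin-≤ {k} d {c} d≤c =
  subst (λ l → toℚ (sumFin d) ℚ.≤ toℚ l * c) (List.length-tabulate {n = k} (λ i → i)) (toℚ-sum-≤ d d≤c (allFin k))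

count-△-≤-⊆ : ∀ {h h′ f : BoolFun n} {δ} .{{_ : NonNegative δ}} →
  h ⊆ f → RelDistLE h h′ δ → toℚ (count (h △ h′)) ℚ.≤ δ * toℚ (count f)
count-△-≤-⊆ {δ = δ} h⊆f dist = ℚ.≤-trans dist (ℚ.*-monoˡ-≤-nonNeg δ (toℚ-mono-≤ (count-mono h⊆f)))

sumFin-count-△-≤ : ∀ {k} (f : BoolFun n) (h h′ : Fin k → BoolFun n) {δ} .{{_ : NonNegative δ}} →
  (∀ i → h i ⊆ f) → (∀ i → RelDistLE (h i) (h′ i) δ) →
  toℚ (sumFin (λ i → count (h i △ h′ i))) ℚ.≤ toℚ k * (δ * toℚ (count f))
sumFin-count-△-≤ f h h′ {δ} h⊆f dist = toℚ-sumFin-≤ _ (λ i → count-△-≤-⊆ {δ = δ} (h⊆f i) (dist i))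

*½+*½ : ∀ p q → p * ½ * q + p * ½ * q ≡ p * q
*½+*½ p q = trans
  (solve 3 (λ p h q → p :* h :* q :+ p :* h :* q := p :* (h :+ h) :* q) refl p ½ q)
  (cong (_* q) (ℚ.*-identityʳ p))
  where open ℚSolver

lemma24 : (n : ℕ) (f : BoolFun n) (s : ℕ) (ε : ℚ) →
    1 ≤ s → 0ℚ < ε →
    (s' : ℕ) → s' ≤ s → (h : Fin s' → BoolFun n) →
    (∀ i (x : Vec Bool n) → h i x ≡ true → f x ≡ true) →
    toℚ (count (λ x → f x ∧ not (bigOr h x))) Data.Rational.≤ (ε * ½) * toℚ (count f) →
    (t : Fin s' → ℕ) →
    (∀ i → Σ (DNF n) (λ φ → length φ ≤ t i × RelDistLE (h i) (evalDNF φ) (divℕ ε (2 Data.Nat.* s)))) →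
    sumFin t ≤ s →
    Σ (DNF n) (λ g → length g ≤ s × RelDistLE f (evalDNF g) ε)
lemma24 n f zero ε () _ _ _ _ _ _ _ _ _
lemma24 n f s@(suc m) ε _ 0<ε s' s'≤s h h⊆f missed t approx Σt≤s = g , length-g≤s , reldist-g
  where
  φ : Fin s' → DNF n
  φ = proj₁ ∘ approx
  g : DNF n
  g = concatMap φ (allFin s')
  F : ℚ
  F = toℚ (count f)
  δ : ℚ
  δ = divℕ ε (2 ℕ.* s)
  instance
    δ-nonNeg : NonNegative δ
    δ-nonNeg = divℕ-nonNeg ε (2 ℕ.* s) {{ℚ.pos⇒nonNeg ε {{ℚ.positive 0<ε}}}}
    δF-nonNeg : NonNegative (δ * F)
    δF-nonNeg = ℚ.nonNeg*nonNeg⇒nonNeg δ F {{toℚ-nonNeg (count f)}}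

  length-g≤s : length g ≤ s
  length-g≤s = ℕ.≤-trans (ℕ.≤-reflexive (length-concatMap φ (allFin s')))
    (ℕ.≤-trans (sum-map-mono (proj₁ ∘ proj₂ ∘ approx) (allFin s')) Σt≤s)

  approximation-error : toℚ (sumFin (λ i → count (h i △ evalDNF (φ i)))) ℚ.≤ ε * ½ * F
  approximation-error = begin
    toℚ (sumFin (λ i → count (h i △ evalDNF (φ i)))) ≤⟨ sumFin-count-△-≤ f h (evalDNF ∘ φ) {δ} h⊆f (λ i → proj₂ (proj₂ (approx i))) ⟩
    toℚ s' * (δ * F)                                 ≤⟨ ℚ.*-monoʳ-≤-nonNeg (δ * F) (toℚ-mono-≤ s'≤s) ⟩
    toℚ s * (δ * F)                                  ≡⟨ ℚ.*-assoc (toℚ s) δ F ⟨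
    toℚ s * δ * F                                    ≡⟨ cong (_* F) (toℚ-*-divℕ-double m ε) ⟩
    ε * ½ * F                                        ∎
    where open ℚ.≤-Reasoning

  reldist-g : RelDistLE f (evalDNF g) ε
  reldist-g = begin
    toℚ (count (f △ evalDNF g))                          ≡⟨ cong toℚ (count-cong (λ x → cong (f x xor_) (evalDNF-concatMap φ (allFin s') x))) ⟩
    toℚ (count (f △ bigOr (evalDNF ∘ φ)))                ≤⟨ toℚ-mono-≤ (count-△-bigOr-≤ f h (evalDNF ∘ φ) h⊆f) ⟩
    toℚ (count (f ∖ bigOr h) ℕ.+ sumFin (λ i → count (h i △ evalDNF (φ i))))
                                                         ≡⟨ toℚ-homo-+ (count (f ∖ bigOr h)) _ ⟩
    toℚ (count (f ∖ bigOr h)) + toℚ (sumFin (λ i → count (h i △ evalDNF (φ i))))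
                                                         ≤⟨ ℚ.+-mono-≤ missed approximation-error ⟩
    ε * ½ * F + ε * ½ * F                                ≡⟨ *½+*½ ε F ⟩
    ε * F                                                ∎
    where open ℚ.≤-Reasoning
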